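{- For all integers $a,b,c,d\in\mathbb Z$ the following are equivalent: (i) $a:b::_{(\mathbb Z,+,\mathbb Z),m}c:d$; (ii) there are $k,\ell,o,u\in\mathbb Z$ with $a=k+o$, $b=\ell+o$, $c=k+u$, $d=\ell+u$; (iii) $a-b=c-d$.
   Context: $(\mathbb Z,+,\mathbb Z)$ is the algebra with universe $\mathbb Z$, the binary operation $+$, and a constant symbol for every integer. General framework: for an algebra $\mathfrak A$ with universe $A$, a justification is a pair of terms $s\to t$ with every variable of $t$ occurring in $s$; $\uparrow_{\mathfrak A}(a\to b)$ is the set of justifications $s\to t$ with $a=s^{\mathfrak A}(\mathbf o)$, $b=t^{\mathfrak A}(\mathbf o)$ for some assignment $\mathbf o$ of elements of $A$ to the variables of $s$. Monolinear fragment: $\uparrow^m_{\mathfrak A}(a\to b)$ consists of those $s\to t\in\uparrow_{\mathfrak A}(a\to b)$ such that $s$ and $t$ contain no variable other than a single fixed variable $x$, which occurs at most once in $s$ and at most once in $t$. Set $\uparrow^m(a\to b:\!\cdot\,c\to d):=\uparrow^m_{\mathfrak A}(a\to b)\cap\uparrow^m_{\mathfrak A}(c\to d)$. A monolinear justification is trivial if it lies in $\uparrow^m(a'\to b':\!\cdot\,c'\to d')$ for all $a',b',c',d'\in A$. The arrow proportion $a\to b:\!\cdot_m\,c\to d$ holds iff either (a) $\uparrow^m_{\mathfrak A}(a\to b)\cup\uparrow^m_{\mathfrak A}(c\to d)$ consists only of trivial justifications, or (b) writing $J_e$ for $\uparrow^m(a\to b:\!\cdot\,c\to e)$ minus its trivial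 justifications, $J_d\ne\emptyset$ and for every $d'\in A$, $J_d\subseteq J_{d'}$ implies $J_{d'}\subseteq J_d$. Finally $a:b::_{\mathfrak A,m}c:d$ holds iff $a\to b:\!\cdot_m\,c\to d$, $b\to a:\!\cdot_m\,d\to c$, $c\to d:\!\cdot_m\,a\to b$ and $d\to c:\!\cdot_m\,b\to a$ all hold. -}

module Defs where

open import Data.Integer using (ℤ; _+_; _-_)
open import Data.Nat using (ℕ; _≤_) renaming (_+_ to _+ℕ_)
open import Data.Product using (Σ; ∃; _×_; _,_)
open import Data.Sum using (_⊎_)
open import Relation.Nullary using (¬_)
open import Relation.Binary.PropositionalEquality using (_≡_)

-- Terms of the algebra (ℤ, +, ℤ) in the single fixed variable x:
-- the variable, a constant symbol for every integer, and binary +.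
data Term : Set where
  var   : Term
  const : ℤ → Term
  _⊕_   : Term → Term → Term

eval : Term → ℤ → ℤ
eval var         o = o
eval (const z)   o = z
eval (s ⊕ t)     o = eval s o + eval t o

occ : Term → ℕ
occ var       = 1
occ (const _) = 0
occ (s ⊕ t)   = occ s +ℕ occ t

record Just : Set where
  constructor _⇒_
  field
    lhs : Term
    rhs : Term

-- Monolinear: x occurs at most once in s and at most once in t, and every
-- variable of t occurs in s (i.e. if x occurs in t then x occurs in s).
Monolinear : Just → Set
Monolinear (s ⇒ t) = occ s ≤ 1 × occ t ≤ 1 × (occ t ≡ 1 → occ s ≡ 1)

Up : ℤ → ℤ → Just → Set
Up a b (s ⇒ t) = Monolinear (s ⇒ t) × ∃ λ o → eval s o ≡ a × eval t o ≡ b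

Up2 : ℤ → ℤ → ℤ → ℤ → Just → Set
Up2 a b c d j = Up a b j × Up c d j

Trivial : Just → Set
Trivial j = ∀ a' b' c' d' → Up2 a' b' c' d' j

JSet : ℤ → ℤ → ℤ → ℤ → Just → Set
JSet a b c e j = Up2 a b c e j × ¬ Trivial j

_⊆J_ : (Just → Set) → (Just → Set) → Set
P ⊆J Q = ∀ j → P j → Q j

Arrow : ℤ → ℤ → ℤ → ℤ → Set
Arrow a b c d =
  (∀ j → Up a b j ⊎ Up c d j → Trivial j)
  ⊎ ((∃ λ j → JSet a b c d j)
     × (∀ d' → JSet a b c d ⊆J JSet a b c d' → JSet a b c d' ⊆J JSet a b c d))

Analogy : ℤ → ℤ → ℤ → ℤ → Set
Analogy a b c d = Arrow a b c d × Arrow b a d c × Arrow c d a b × Arrow d c b a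

-- A monolinear term evaluates to a constant or to the assignment shifted by a
-- constant, so a justification s → t either pins the target (t constant) or
-- moves every source by the same amount t(0) − s(0).  Hence no justification is
-- trivial, and a → b :·ₘ c → d forces d = b or b − a = d − c.  Conversely, if
-- b − a = d − c then x → x + (b − a) lies in J_d and in no other J_d', so J_d is
-- maximal.  In an analogy, a → b :·ₘ c → d and b → a :·ₘ d → c can only both be
-- degenerate when c = a and d = b, which again gives a − b = c − d.
module Submission where

open import Defs
open import Data.Integer using (ℤ; _+_; _-_; _*_; +_; 0ℤ; 1ℤ)
open import Data.Integer.Properties
  using (pos-+; +-identityˡ; +-identityʳ; *-identityˡ; *-zeroˡ)
open import Data.Integer.Tactic.RingSolver using (solve-∀)
open import Data.Empty using (⊥-elim)
open import Data.Nat using (z≤n; s≤s)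
open import Data.Nat.Properties using (n≤1⇒n≡0∨n≡1)
open import Data.Product using (∃; _×_; _,_)
open import Data.Sum using (_⊎_; inj₁; inj₂)
open import Function using (_∘_)
open import Function.Bundles using (_⇔_; mk⇔)
open import Relation.Nullary using (¬_)
open import Relation.Binary.PropositionalEquality
  using (_≡_; refl; sym; trans; cong; cong₂; subst; module ≡-Reasoning)
open ≡-Reasoning

a-b≡c-d⇒b-a≡d-c : ∀ a b c d → a - b ≡ c - d → b - a ≡ d - c
a-b≡c-d⇒b-a≡d-c a b c d h = begin
  b - a         ≡⟨ negated a b ⟩
  0ℤ - (a - b)  ≡⟨ cong (0ℤ -_) h ⟩
  0ℤ - (c - d)  ≡⟨ negated c d ⟨
  d - c         ∎
  where
  negated : ∀ x y → y - x ≡ 0ℤ - (x - y)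
  negated = solve-∀

[n-m]+m≡n : ∀ m n → (n - m) + m ≡ n
[n-m]+m≡n = solve-∀

b-a≡d-c⇒d≡[b-a]+c : ∀ a b c d → b - a ≡ d - c → d ≡ (b - a) + c
b-a≡d-c⇒d≡[b-a]+c a b c d h = begin
  d            ≡⟨ [n-m]+m≡n c d ⟨
  (d - c) + c  ≡⟨ cong (λ x → x + c) h ⟨
  (b - a) + c  ∎

eval-affine : ∀ s o → eval s o ≡ eval s 0ℤ + + occ s * o
eval-affine var       o = sym (trans (+-identityˡ (+ 1 * o)) (*-identityˡ o))
eval-affine (const z) o = sym (trans (cong (λ x → z + x) (*-zeroˡ o)) (+-identityʳ z))
eval-affine (s ⊕ t)   o = begin
  eval s o + eval t o                   ≡⟨ cong₂ _+_ (eval-affine s o) (eval-affine t o) ⟩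
  (S + + occ s * o) + (T + + occ t * o) ≡⟨ interchange S T (+ occ s) (+ occ t) o ⟩
  (S + T) + (+ occ s + + occ t) * o     ≡⟨ cong (λ k → (S + T) + k * o) (pos-+ (occ s) (occ t)) ⟨
  (S + T) + + occ (s ⊕ t) * o           ∎
  where
  S = eval s 0ℤ
  T = eval t 0ℤ
  interchange : ∀ S T m n o → (S + m * o) + (T + n * o) ≡ (S + T) + (m + n) * o
  interchange = solve-∀

eval-constant : ∀ t → occ t ≡ 0 → ∀ o o' → eval t o ≡ eval t o'
eval-constant t occ≡0 o o' = begin
  eval t o              ≡⟨ eval-affine t o ⟩
  T + + occ t * o       ≡⟨ cong (λ n → T + + n * o) occ≡0 ⟩
  T + + 0 * o           ≡⟨ cong (λ x → T + x) (trans (*-zeroˡ o) (sym (*-zeroˡ o'))) ⟩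
  T + + 0 * o'          ≡⟨ cong (λ n → T + + n * o') occ≡0 ⟨
  T + + occ t * o'      ≡⟨ eval-affine t o' ⟨
  eval t o'             ∎
  where T = eval t 0ℤ

eval-difference : ∀ s t → occ s ≡ occ t → ∀ o → eval t o - eval s o ≡ eval t 0ℤ - eval s 0ℤ
eval-difference s t occ≡ o = begin
  eval t o - eval s o                    ≡⟨ cong₂ _-_ (eval-affine t o) (eval-affine s o) ⟩
  (T + + occ t * o) - (S + + occ s * o)  ≡⟨ cong (λ n → (T + + occ t * o) - (S + + n * o)) occ≡ ⟩
  (T + + occ t * o) - (S + + occ t * o)  ≡⟨ cancel T S (+ occ t * o) ⟩
  T - S                                  ∎
  where
  S = eval s 0ℤ
  T = eval t 0ℤ
  cancel : ∀ T S x → (T + x) - (S + x) ≡ T - S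
  cancel = solve-∀

Up2⇒≡⊎b-a≡e-c : ∀ {a b c e} j → Up2 a b c e j → e ≡ b ⊎ b - a ≡ e - c
Up2⇒≡⊎b-a≡e-c (s ⇒ t) (((_ , occt≤1 , occt≡1⇒occs≡1) , o , refl , refl) , (_ , o' , refl , refl))
  with n≤1⇒n≡0∨n≡1 occt≤1
... | inj₁ occt≡0 = inj₁ (eval-constant t occt≡0 o' o)
... | inj₂ occt≡1 = inj₂ (trans (eval-difference s t occ≡ o) (sym (eval-difference s t occ≡ o')))
  where
  occ≡ : occ s ≡ occ t
  occ≡ = trans (occt≡1⇒occs≡1 occt≡1) (sym occt≡1)

¬Trivial : ∀ j → ¬ Trivial j
¬Trivial j trivial with Up2⇒≡⊎b-a≡e-c j (trivial 0ℤ 0ℤ 0ℤ 1ℤ)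
... | inj₁ ()
... | inj₂ ()

Up-constants : ∀ a b → Up a b (const a ⇒ const b)
Up-constants a b = (z≤n , z≤n , λ ()) , 0ℤ , refl , refl

Arrow⇒≡⊎b-a≡d-c : ∀ a b c d → Arrow a b c d → d ≡ b ⊎ b - a ≡ d - c
Arrow⇒≡⊎b-a≡d-c a b _ _ (inj₁ allTrivial) =
  ⊥-elim (¬Trivial (const a ⇒ const b) (allTrivial (const a ⇒ const b) (inj₁ (Up-constants a b))))
Arrow⇒≡⊎b-a≡d-c _ _ _ _ (inj₂ ((j , j∈Up2 , _) , _)) = Up2⇒≡⊎b-a≡e-c j j∈Up2

shift : ℤ → Just
shift k = var ⇒ (const k ⊕ var)

Up-shift : ∀ k o → Up o (k + o) (shift k)
Up-shift k o = (s≤s z≤n , s≤s z≤n , λ _ → refl) , o , refl , refl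

Up-shift⇒≡ : ∀ k {c d} → Up c d (shift k) → d ≡ k + c
Up-shift⇒≡ _ (_ , o , refl , refl) = refl

b-a≡d-c⇒Arrow : ∀ a b c d → b - a ≡ d - c → Arrow a b c d
b-a≡d-c⇒Arrow a b c d h = inj₂ ((shift k , shift∈J) , maximal)
  where
  k = b - a
  d≡k+c : d ≡ k + c
  d≡k+c = b-a≡d-c⇒d≡[b-a]+c a b c d h
  shift∈J : JSet a b c d (shift k)
  shift∈J = ( subst (λ y → Up a y (shift k)) ([n-m]+m≡n a b) (Up-shift k a)
            , subst (λ y → Up c y (shift k)) (sym d≡k+c) (Up-shift k c) )
          , ¬Trivial (shift k)
  maximal : ∀ d' → JSet a b c d ⊆J JSet a b c d' → JSet a b c d' ⊆J JSet a b c d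
  maximal d' J_d⊆J_d' = subst (λ y → JSet a b c y ⊆J JSet a b c d) (sym d'≡d) (λ _ j∈J → j∈J)
    where
    d'≡d : d' ≡ d
    d'≡d with J_d⊆J_d' (shift k) shift∈J
    ... | ((_ , shift∈Up) , _) = trans (Up-shift⇒≡ k shift∈Up) (sym d≡k+c)

Analogy⇒a-b≡c-d : ∀ a b c d → Analogy a b c d → a - b ≡ c - d
Analogy⇒a-b≡c-d a b c d (ab:cd , ba:dc , _)
  with Arrow⇒≡⊎b-a≡d-c a b c d ab:cd | Arrow⇒≡⊎b-a≡d-c b a d c ba:dc
... | _                | inj₂ a-b≡c-d = a-b≡c-d
... | inj₂ b-a≡d-c     | inj₁ _       = a-b≡c-d⇒b-a≡d-c b a d c b-a≡d-c
... | inj₁ refl        | inj₁ refl    = refl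

a-b≡c-d⇒Analogy : ∀ a b c d → a - b ≡ c - d → Analogy a b c d
a-b≡c-d⇒Analogy a b c d h =
    b-a≡d-c⇒Arrow a b c d h′ , b-a≡d-c⇒Arrow b a d c h
  , b-a≡d-c⇒Arrow c d a b (sym h′) , b-a≡d-c⇒Arrow d c b a (sym h)
  where h′ = a-b≡c-d⇒b-a≡d-c a b c d h

Translates : ℤ → ℤ → ℤ → ℤ → Set
Translates a b c d = ∃ λ k → ∃ λ l → ∃ λ o → ∃ λ u →
  a ≡ k + o × b ≡ l + o × c ≡ k + u × d ≡ l + u

Translates⇒a-b≡c-d : ∀ a b c d → Translates a b c d → a - b ≡ c - d
Translates⇒a-b≡c-d _ _ _ _ (k , l , o , u , refl , refl , refl , refl) =
  trans (cancel k l o) (sym (cancel k l u))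
  where
  cancel : ∀ k l o → (k + o) - (l + o) ≡ k - l
  cancel = solve-∀

a-b≡c-d⇒Translates : ∀ a b c d → a - b ≡ c - d → Translates a b c d
a-b≡c-d⇒Translates a b c d h =
  0ℤ , b - a , a , c
  , sym (+-identityˡ a) , sym ([n-m]+m≡n a b) , sym (+-identityˡ c)
  , b-a≡d-c⇒d≡[b-a]+c a b c d (a-b≡c-d⇒b-a≡d-c a b c d h)

mainTheorem4 : (a b c d : ℤ) →
    (Analogy a b c d ⇔ (∃ λ k → ∃ λ l → ∃ λ o → ∃ λ u →
        a ≡ k + o × b ≡ l + o × c ≡ k + u × d ≡ l + u))
    × ((∃ λ k → ∃ λ l → ∃ λ o → ∃ λ u →
        a ≡ k + o × b ≡ l + o × c ≡ k + u × d ≡ l + u) ⇔ (a - b ≡ c - d))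
mainTheorem4 a b c d =
    mk⇔ (a-b≡c-d⇒Translates a b c d ∘ Analogy⇒a-b≡c-d a b c d)
        (a-b≡c-d⇒Analogy a b c d ∘ Translates⇒a-b≡c-d a b c d)
  , mk⇔ (Translates⇒a-b≡c-d a b c d) (a-b≡c-d⇒Translates a b c d)
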